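{- If a function $f:\mathbb{N}\to\mathbb{N}$ is computable by a family $\mathcal{C}=(C_n)_{n\ge0}$ of polynomial-size and constant-depth Boolean circuits (in the normal form of the context; $f(x)$ is the output of $C_{\ell(x)}$ on input $x$), then $f\in\mathbb{ACDL}_{\mathcal{C}}$.
   Context: $\ell(x)=\lceil\log_2(x+1)\rceil$ is the binary length of $x$; $\mathrm{sg}(x)=1$ if $x>0$, else $0$; $x\div2=\lfloor x/2\rfloor$. The length-ODE $\frac{\partial f(x,\vec y)}{\partial \ell}=E(x,\vec y)$ means $f(x+1,\vec y)=f(x,\vec y)+(\ell(x+1)-\ell(x))\cdot E(x,\vec y)$. Schema $\ell$-ODE$_2$: given $g,h,k$ with $h\in\{0,1\}$ and $k(\vec y)\ne0$ whenever $h(x,\vec y)=1$ for some $x$, $f$ solves $f(0,\vec y)=g(\vec y)$, $\frac{\partial f}{\partial\ell}=(2^{\ell(k(\vec y))}-1)f(x,\vec y)+h(x,\vec y)$. Schema $\ell$-ODE$_3$: $f(0,\vec y)=g(\vec y)$, $\frac{\partial f}{\partial\ell}=-(f(x,\vec y)-(f(x,\vec y)\div 2))$. Standing assumption on the family: $C_n$ has size $n^k$ (fixed $k$) and constant even depth $d$, and is in normal form: unbounded fan-in, input gates and negations of input gates at level 0, all gates at odd levels are $\vee$, all gates at even levels $\ge2$ are $\wedge$ (so outputs are $\wedge$ gates), edges only between consecutive levels; input gates numbered $0,\dots,n-1$, negated inputs $n,\dots,2n-1$, the $m$ output gates $n^k-m,\dots,n^k-1$; the output is the binary number formed by the output gates.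 No uniformity is assumed. The set $\mathbf{circ}_{\mathcal{C}}=\{C,L_0^{in},L_0^{\neg},L_1,\dots,L_d,m\}$ consists of (characteristic functions of) predicates $L_0^{in},L_0^{\neg},L_e\subseteq\mathbb{N}^2$, $C\subseteq\mathbb{N}^3$ and $m:\mathbb{N}\to\mathbb{N}$: $m(\ell(x))$ is the number of output gates of $C_{\ell(x)}$; $L_0^{in}(a,x)$, $L_0^{\neg}(a,x)$ describe input and negated-input gates of $C_{\ell(x)}$ on input $x$; $L_e(a,x)$ holds iff the $a$-th gate of $C_{\ell(x)}$ is at level $e$; $(x,a,b)\in C$ iff in $C_{\ell(x)}$ gate $a$ is a predecessor of gate $b$ at the next level ($a,b\le\ell(x)^k$). $\mathbb{ACDL}_{\mathcal{C}}=[\mathbf{0},\mathbf{1},\mathbf{circ}_{\mathcal{C}},\mathrm{sg},\ell,+,-,\div2,\pi^p_i;\ \circ,\ \ell\text{ -ODE}_2,\ \ell\text{ -ODE}_3]$, the smallest class containing these basic functions (constants, projections) and closed under composition and the two schemas. -}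

module Defs where

open import Data.Nat using (ℕ; zero; suc; _+_; _*_; _∸_; _^_; _≤_; _<_; _%_; _/_; ⌊_/2⌋; _<ᵇ_; _≡ᵇ_)
open import Data.Nat.Logarithm using (⌈log₂_⌉)
open import Data.Bool using (Bool; true; false; if_then_else_; not; _∧_; _∨_)
open import Data.Fin using (Fin)
open import Data.Vec using (Vec; []; _∷_; lookup; tabulate; head; tail)
open import Data.Product using (Σ; _×_)
open import Relation.Binary.PropositionalEquality using (_≡_; _≢_)

ℓ : ℕ → ℕ
ℓ x = ⌈log₂ (suc x) ⌉

sg : ℕ → ℕ
sg zero    = 0
sg (suc _) = 1

half : ℕ → ℕ
half x = ⌊ x /2⌋

bit : ℕ → ℕ → ℕ
bit zero    x = x % 2
bit (suc i) x = bit i ⌊ x /2⌋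

toℕ𝔹 : Bool → ℕ
toℕ𝔹 true  = 1
toℕ𝔹 false = 0

-- For every n, the circuit C_n has gates numbered 0 … size n - 1.
-- level n a   : level of gate a in C_n
-- edge n a b  : gate a is a predecessor of gate b in C_n
-- outs n      : number m of output gates of C_n (gates size n - m … size n - 1)

record CircuitFamily : Set where
  field
    depth : ℕ
    size  : ℕ → ℕ
    level : ℕ → ℕ → ℕ
    edge  : ℕ → ℕ → ℕ → Bool
    outs  : ℕ → ℕ
    -- constant even depth d (≥ 2, since outputs are ∧ gates at an even level ≥ 2)
    depth-even : depth % 2 ≡ 0
    depth-≥2   : 2 ≤ depth
    polyK polyC : ℕ
    size-poly   : ∀ n → size n ≤ polyC * n ^ polyK + polyC
    inputs-fit  : ∀ n → 2 * n ≤ size n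
    outs-fit    : ∀ n → outs n ≤ size n
    -- level 0 consists exactly of the input gates 0..n-1 and negated inputs n..2n-1
    level0      : ∀ n a → a < size n → (level n a ≡ 0 → a < 2 * n) × (a < 2 * n → level n a ≡ 0)
    level-≤d    : ∀ n a → a < size n → level n a ≤ depth
    edge-ok     : ∀ n a b → edge n a b ≡ true →
                    (a < size n) × (b < size n) × (level n b ≡ suc (level n a))
    outs-level  : ∀ n a → size n ∸ outs n ≤ a → a < size n → level n a ≡ depth

module _ (F : CircuitFamily) where
  open CircuitFamily F

  anyBelow : ℕ → (ℕ → Bool) → Bool
  anyBelow zero    p = false
  anyBelow (suc s) p = p s ∨ anyBelow s p

  allBelow : ℕ → (ℕ → Bool) → Bool
  allBelow zero    p = true
  allBelow (suc s) p = p s ∧ allBelow s p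

  valAt : (n x e a : ℕ) → Bool
  valAt n x zero a =
    if a <ᵇ n then bit a x ≡ᵇ 1
    else (if a <ᵇ 2 * n then bit (a ∸ n) x ≡ᵇ 0 else false)
  valAt n x (suc e) b =
    if suc e % 2 ≡ᵇ 1
    then anyBelow (size n) (λ a → edge n a b ∧ valAt n x e a)
    else allBelow (size n) (λ a → not (edge n a b) ∨ valAt n x e a)

  gateVal : (n x a : ℕ) → Bool
  gateVal n x a = valAt n x (level n a) a

  outputSum : (n x m j : ℕ) → ℕ
  outputSum n x m zero    = 0
  outputSum n x m (suc j) =
    outputSum n x m j + 2 ^ j * toℕ𝔹 (gateVal n x (size n ∸ m + j))

  output : (n x : ℕ) → ℕ
  output n x = outputSum n x (outs n) (outs n)

  Computes : (ℕ → ℕ) → Set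
  Computes f = ∀ x → f x ≡ output (ℓ x) x

  circC : ℕ → ℕ → ℕ → ℕ
  circC x a b = toℕ𝔹 (edge (ℓ x) a b)

  circL0in : ℕ → ℕ → ℕ
  circL0in a x = toℕ𝔹 ((a <ᵇ ℓ x) ∧ (bit a x ≡ᵇ 1))

  circL0neg : ℕ → ℕ → ℕ
  circL0neg a x = toℕ𝔹 (not (a <ᵇ ℓ x) ∧ (a <ᵇ 2 * ℓ x) ∧ (bit (a ∸ ℓ x) x ≡ᵇ 0))

  circL : ℕ → ℕ → ℕ → ℕ
  circL e a x = toℕ𝔹 ((a <ᵇ size (ℓ x)) ∧ (level (ℓ x) a ≡ᵇ e))

  circM : ℕ → ℕ
  circM n = outs n

  -- ℓ(x+1) - ℓ(x)  (always 0 or 1)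
  Δℓ : ℕ → ℕ
  Δℓ x = ℓ (suc x) ∸ ℓ x

  -- ℓ-ODE₂:  f(0,y) = g(y),  ∂f/∂ℓ = (2^{ℓ(k(y))} - 1) f(x,y) + h(x,y)
  odeSol₂ : ∀ {p} → (Vec ℕ p → ℕ) → (Vec ℕ (suc p) → ℕ) → (Vec ℕ p → ℕ) → ℕ → Vec ℕ p → ℕ
  odeSol₂ g h k zero    y = g y
  odeSol₂ g h k (suc x) y =
    odeSol₂ g h k x y
      + Δℓ x * ((2 ^ ℓ (k y) ∸ 1) * odeSol₂ g h k x y + h (x ∷ y))

  -- ℓ-ODE₃:  f(0,y) = g(y),  ∂f/∂ℓ = -(f(x,y) - (f(x,y) ÷ 2))
  -- (the added quantity is non-positive and at most f(x,y) in absolute value,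
  --  so the update is the truncated subtraction below)
  odeSol₃ : ∀ {p} → (Vec ℕ p → ℕ) → ℕ → Vec ℕ p → ℕ
  odeSol₃ g zero    y = g y
  odeSol₃ g (suc x) y =
    odeSol₃ g x y ∸ Δℓ x * (odeSol₃ g x y ∸ half (odeSol₃ g x y))

  uncurryODE : ∀ {p} → (ℕ → Vec ℕ p → ℕ) → Vec ℕ (suc p) → ℕ
  uncurryODE f v = f (head v) (tail v)

  data ACDL : (p : ℕ) → (Vec ℕ p → ℕ) → Set where
    zeroF  : ACDL 0 (λ _ → 0)
    oneF   : ACDL 0 (λ _ → 1)
    circCF : ACDL 3 (λ v → circC (lookup v Fin.zero) (lookup v (Fin.suc Fin.zero))
                                 (lookup v (Fin.suc (Fin.suc Fin.zero))))
    circL0inF  : ACDL 2 (λ v → circL0in (lookup v Fin.zero) (lookup v (Fin.suc Fin.zero)))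
    circL0negF : ACDL 2 (λ v → circL0neg (lookup v Fin.zero) (lookup v (Fin.suc Fin.zero)))
    circLF : (e : ℕ) → 1 ≤ e → e ≤ depth →
             ACDL 2 (λ v → circL e (lookup v Fin.zero) (lookup v (Fin.suc Fin.zero)))
    circMF : ACDL 1 (λ v → circM (lookup v Fin.zero))
    sgF    : ACDL 1 (λ v → sg (lookup v Fin.zero))
    ℓF     : ACDL 1 (λ v → ℓ (lookup v Fin.zero))
    plusF  : ACDL 2 (λ v → lookup v Fin.zero + lookup v (Fin.suc Fin.zero))
    minusF : ACDL 2 (λ v → lookup v Fin.zero ∸ lookup v (Fin.suc Fin.zero))
    halfF  : ACDL 1 (λ v → half (lookup v Fin.zero))
    projF  : (p : ℕ) (i : Fin p) → ACDL p (λ v → lookup v i)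
    compF  : ∀ {p q} {h : Vec ℕ q → ℕ} {gs : Fin q → Vec ℕ p → ℕ} →
             ACDL q h → (∀ i → ACDL p (gs i)) →
             ACDL p (λ v → h (tabulate (λ i → gs i v)))
    ode₂F  : ∀ {p} {g : Vec ℕ p → ℕ} {h : Vec ℕ (suc p) → ℕ} {k : Vec ℕ p → ℕ} →
             ACDL p g → ACDL (suc p) h → ACDL p k →
             (∀ v → h v ≤ 1) →
             (∀ x y → h (x ∷ y) ≡ 1 → k y ≢ 0) →
             ACDL (suc p) (uncurryODE (odeSol₂ g h k))
    ode₃F  : ∀ {p} {g : Vec ℕ p → ℕ} →
             ACDL p g → ACDL (suc p) (uncurryODE (odeSol₃ g))

  InACDL : (ℕ → ℕ) → Set
  InACDL f = Σ (Vec ℕ 1 → ℕ) (λ g → ACDL 1 g × (∀ x → g (x ∷ []) ≡ f x))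

{-# OPTIONS --safe #-}
-- Composition with the circuit predicates reduces everything to bounded quantification over the
-- gates of C_{ℓ(x)}. With k = 1 and h ∈ {0,1}, the ℓ-ODE₂ solution doubles and adds the bit h
-- each time ℓ increments, so it evaluates the binary numeral Σ_{i<ℓ(t)} 2^i P(i); its sign is a
-- bounded ∃. With h = 0 it yields 2^{ℓ(a)ℓ(b)}; iterating this gives a term bound(x) whose length
-- exceeds the polynomial size of C_{ℓ(x)}, so ∃ and ∀ over all gates are definable. Gate values
-- follow level by level (∃ over predecessors at ∨-levels, ∀ at ∧-levels), the size of the circuit
-- is the length of the numeral whose digits say "i is a gate", and the output is the numeral whose
-- digits are the values of the output gates.
module Submission where

open import Defs
open import Data.Nat using (ℕ)

open import Data.Bool using (Bool; true; false; not; _∧_; _∨_; if_then_else_)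
open import Data.Bool.Properties using (∨-zeroʳ)
open import Data.Fin using (Fin; zero; suc)
open import Data.Nat using (zero; suc; _+_; _*_; _∸_; _^_; _≤_; _<_; _%_; z≤n; s≤s; _<ᵇ_; _≡ᵇ_; _<?_; _≟_)
open import Data.Nat.Logarithm using (⌈log₂_⌉; ⌈log₂⌉-mono-≤; ⌈log₂2*n⌉≡1+⌈log₂n⌉; ⌈log₂2^n⌉≡n)
open import Data.Nat.Properties
open import Data.Nat.Solver using (module +-*-Solver)
open import Data.Product using (_,_; proj₁)
open import Data.Sum using (_⊎_; inj₁; inj₂)
open import Data.Vec using (Vec; []; _∷_; lookup; tabulate; head; tail)
open import Data.Vec.Properties using (tabulate∘lookup; tabulate-cong)
open import Relation.Binary.PropositionalEquality
open import Relation.Nullary using (yes; no; contradiction)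
open import Relation.Nullary.Decidable using (dec-true; dec-false)

open +-*-Solver using (solve; _:+_; _:*_; _:=_; con)

<ᵇ-true : ∀ {m n} → m < n → (m <ᵇ n) ≡ true
<ᵇ-true {m} {n} = dec-true (m <? n)

<ᵇ-false : ∀ {m n} → n ≤ m → (m <ᵇ n) ≡ false
<ᵇ-false {m} {n} n≤m = dec-false (m <? n) (≤⇒≯ n≤m)

ℓ-mono-≤ : ∀ {x y} → x ≤ y → ℓ x ≤ ℓ y
ℓ-mono-≤ x≤y = ⌈log₂⌉-mono-≤ (s≤s x≤y)

ℓ-2x+1 : ∀ x → ℓ (suc (x + x)) ≡ suc (ℓ x)
ℓ-2x+1 x = trans (cong ⌈log₂_⌉ 2+2x≡2*[1+x]) (⌈log₂2*n⌉≡1+⌈log₂n⌉ (suc x))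
  where
  2+2x≡2*[1+x] : suc (suc (x + x)) ≡ 2 * suc x
  2+2x≡2*[1+x] = solve 1 (λ x → con 2 :+ (x :+ x) := con 2 :* (con 1 :+ x)) refl x

ℓ-suc-≤ : ∀ x → ℓ (suc x) ≤ suc (ℓ x)
ℓ-suc-≤ x = subst (ℓ (suc x) ≤_) (ℓ-2x+1 x) (ℓ-mono-≤ (s≤s (m≤m+n x x)))

ℓ-suc : ∀ x → ℓ (suc x) ≡ ℓ x ⊎ ℓ (suc x) ≡ suc (ℓ x)
ℓ-suc x with m≤n⇒m<n∨m≡n (ℓ-suc-≤ x)
... | inj₁ (s≤s ℓ[1+x]≤ℓx) = inj₁ (≤-antisym ℓ[1+x]≤ℓx (ℓ-mono-≤ (n≤1+n x)))
... | inj₂ ℓ[1+x]≡1+ℓx    = inj₂ ℓ[1+x]≡1+ℓx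

ℓ-2^ : ∀ n → n ≤ ℓ (2 ^ n)
ℓ-2^ n = subst (_≤ ℓ (2 ^ n)) (⌈log₂2^n⌉≡n n) (⌈log₂⌉-mono-≤ (n≤1+n (2 ^ n)))

suc≡2^⇒ℓ≡ : ∀ {y} n → suc y ≡ 2 ^ n → ℓ y ≡ n
suc≡2^⇒ℓ≡ n eq = trans (cong ⌈log₂_⌉ eq) (⌈log₂2^n⌉≡n n)

smash : ℕ → ℕ → ℕ
smash a b = 2 ^ (ℓ a * ℓ b)

ℓ-smash : ∀ a b → ℓ a * ℓ b ≤ ℓ (smash a b)
ℓ-smash a b = ℓ-2^ (ℓ a * ℓ b)

stretch : ℕ → ℕ → ℕ → ℕ
stretch c zero    x = c
stretch c (suc i) x = smash (stretch c i x) (suc (x + x))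

ℓ-stretch : ∀ c i x → ℓ c * suc (ℓ x) ^ i ≤ ℓ (stretch c i x)
ℓ-stretch c zero    x = ≤-reflexive (*-identityʳ (ℓ c))
ℓ-stretch c (suc i) x = begin
  ℓ c * (suc (ℓ x) * suc (ℓ x) ^ i)      ≡⟨ solve 3 (λ a b d → a :* (b :* d) := (a :* d) :* b)
                                                   refl (ℓ c) (suc (ℓ x)) (suc (ℓ x) ^ i) ⟩
  ℓ c * suc (ℓ x) ^ i * suc (ℓ x)        ≤⟨ *-monoˡ-≤ (suc (ℓ x)) (ℓ-stretch c i x) ⟩
  ℓ (stretch c i x) * suc (ℓ x)          ≡⟨ cong (ℓ (stretch c i x) *_) (sym (ℓ-2x+1 x)) ⟩
  ℓ (stretch c i x) * ℓ (suc (x + x))    ≤⟨ ℓ-smash (stretch c i x) (suc (x + x)) ⟩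
  ℓ (stretch c (suc i) x)                ∎
  where open ≤-Reasoning

poly-≤ : ∀ c k n → c * n ^ k + c ≤ 2 * c * suc n ^ k
poly-≤ c k n = begin
  c * n ^ k + c                   ≤⟨ +-mono-≤ (*-monoʳ-≤ c (^-monoˡ-≤ k (n≤1+n n))) c≤c*[1+n]^k ⟩
  c * suc n ^ k + c * suc n ^ k   ≡⟨ solve 2 (λ c y → c :* y :+ c :* y := con 2 :* c :* y) refl c (suc n ^ k) ⟩
  2 * c * suc n ^ k               ∎
  where
  open ≤-Reasoning
  c≤c*[1+n]^k : c ≤ c * suc n ^ k
  c≤c*[1+n]^k = subst (_≤ c * suc n ^ k) (*-identityʳ c) (*-monoʳ-≤ c (m^n>0 (suc n) k))

-- Binary numerals

binary : (ℕ → ℕ) → ℕ → ℕ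
binary P zero    = 0
binary P (suc n) = binary P n + 2 ^ n * P n

binary-cong : ∀ {P Q} n → (∀ i → i < n → P i ≡ Q i) → binary P n ≡ binary Q n
binary-cong zero    P≡Q = refl
binary-cong (suc n) P≡Q =
  cong₂ (λ s d → s + 2 ^ n * d) (binary-cong n (λ i i<n → P≡Q i (m<n⇒m<1+n i<n))) (P≡Q n ≤-refl)

binary-vanishing : ∀ {P s} N → s ≤ N → (∀ i → s ≤ i → P i ≡ 0) → binary P N ≡ binary P s
binary-vanishing zero    z≤n   P≡0 = refl
binary-vanishing {P} {s} (suc N) s≤1+N P≡0 with m≤n⇒m<n∨m≡n s≤1+N
... | inj₂ refl    = refl
... | inj₁ (s≤s s≤N) = begin
  binary P N + 2 ^ N * P N   ≡⟨ cong (λ d → binary P N + 2 ^ N * d) (P≡0 N s≤N) ⟩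
  binary P N + 2 ^ N * 0     ≡⟨ cong (binary P N +_) (*-zeroʳ (2 ^ N)) ⟩
  binary P N + 0             ≡⟨ +-identityʳ (binary P N) ⟩
  binary P N                 ≡⟨ binary-vanishing N s≤N P≡0 ⟩
  binary P s                 ∎
  where open ≡-Reasoning

binary-lsd : ∀ P n → binary P (suc n) ≡ P 0 + 2 * binary (λ i → P (suc i)) n
binary-lsd P zero    = refl
binary-lsd P (suc n) = begin
  binary P (suc n) + 2 ^ suc n * P (suc n)   ≡⟨ cong (_+ 2 ^ suc n * P (suc n)) (binary-lsd P n) ⟩
  P 0 + 2 * B + 2 * 2 ^ n * P (suc n)        ≡⟨ solve 4 (λ d b y e → d :+ con 2 :* b :+ con 2 :* y :* e
                                                             := d :+ con 2 :* (b :+ y :* e))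
                                                        refl (P 0) B (2 ^ n) (P (suc n)) ⟩
  P 0 + 2 * (B + 2 ^ n * P (suc n))          ∎
  where
  open ≡-Reasoning
  B = binary (λ i → P (suc i)) n

binary-ones : ∀ n → suc (binary (λ _ → 1) n) ≡ 2 ^ n
binary-ones zero    = refl
binary-ones (suc n) = begin
  suc (binary (λ _ → 1) n) + 2 ^ n * 1   ≡⟨ cong₂ _+_ (binary-ones n) (*-identityʳ (2 ^ n)) ⟩
  2 ^ n + 2 ^ n                          ≡⟨ cong (2 ^ n +_) (sym (+-identityʳ (2 ^ n))) ⟩
  2 ^ suc n                              ∎
  where open ≡-Reasoning

horner : ℕ → ℕ → (ℕ → ℕ) → ℕ → ℕ
horner b c H zero    = c
horner b c H (suc j) = b * horner b c H j + H j

horner-pow : ∀ b j → horner b 1 (λ _ → 0) j ≡ b ^ j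
horner-pow b zero    = refl
horner-pow b (suc j) = trans (+-identityʳ _) (cong (b *_) (horner-pow b j))

horner-binary : ∀ H N → horner 2 0 H N ≡ binary (λ i → H (N ∸ suc i)) N
horner-binary H zero    = refl
horner-binary H (suc N) = begin
  2 * horner 2 0 H N + H N                   ≡⟨ cong (λ s → 2 * s + H N) (horner-binary H N) ⟩
  2 * binary (λ i → H (N ∸ suc i)) N + H N   ≡⟨ +-comm _ (H N) ⟩
  H N + 2 * binary (λ i → H (N ∸ suc i)) N   ≡⟨ sym (binary-lsd (λ i → H (suc N ∸ suc i)) N) ⟩
  binary (λ i → H (suc N ∸ suc i)) (suc N)   ∎
  where open ≡-Reasoning

m∸suc[m∸suc[n]]≡n : ∀ {m n} → n < m → m ∸ suc (m ∸ suc n) ≡ n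
m∸suc[m∸suc[n]]≡n {suc m} (s≤s n≤m) = m∸[m∸n]≡n n≤m

horner-reversed-binary : ∀ P N → horner 2 0 (λ j → P (N ∸ suc j)) N ≡ binary P N
horner-reversed-binary P N =
  trans (horner-binary _ N) (binary-cong N (λ i i<N → cong P (m∸suc[m∸suc[n]]≡n i<N)))

ℓ-binary-<ᵇ : ∀ {s} N → s ≤ N → ℓ (binary (λ i → toℕ𝔹 (i <ᵇ s)) N) ≡ s
ℓ-binary-<ᵇ {s} N s≤N = suc≡2^⇒ℓ≡ s (begin
  suc (binary Q N)          ≡⟨ cong suc (binary-vanishing N s≤N (λ i s≤i → cong toℕ𝔹 (<ᵇ-false s≤i))) ⟩
  suc (binary Q s)          ≡⟨ cong suc (binary-cong s (λ i i<s → cong toℕ𝔹 (<ᵇ-true i<s))) ⟩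
  suc (binary (λ _ → 1) s)  ≡⟨ binary-ones s ⟩
  2 ^ s                     ∎)
  where
  open ≡-Reasoning
  Q = λ i → toℕ𝔹 (i <ᵇ s)

toℕ𝔹≤1 : ∀ b → toℕ𝔹 b ≤ 1
toℕ𝔹≤1 true  = s≤s z≤n
toℕ𝔹≤1 false = z≤n

toℕ𝔹-not : ∀ b → 1 ∸ toℕ𝔹 b ≡ toℕ𝔹 (not b)
toℕ𝔹-not true  = refl
toℕ𝔹-not false = refl

toℕ𝔹-∧ : ∀ a b → toℕ𝔹 a + toℕ𝔹 b ∸ 1 ≡ toℕ𝔹 (a ∧ b)
toℕ𝔹-∧ true  b     = refl
toℕ𝔹-∧ false true  = refl
toℕ𝔹-∧ false false = refl

toℕ𝔹-∨ : ∀ a b → sg (toℕ𝔹 a + toℕ𝔹 b) ≡ toℕ𝔹 (a ∨ b)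
toℕ𝔹-∨ true  b     = refl
toℕ𝔹-∨ false true  = refl
toℕ𝔹-∨ false false = refl

toℕ𝔹-<ᵇ : ∀ m n → sg (n ∸ m) ≡ toℕ𝔹 (m <ᵇ n)
toℕ𝔹-<ᵇ zero    zero    = refl
toℕ𝔹-<ᵇ zero    (suc n) = refl
toℕ𝔹-<ᵇ (suc m) zero    = refl
toℕ𝔹-<ᵇ (suc m) (suc n) = toℕ𝔹-<ᵇ m n

toℕ𝔹-if-if : ∀ b c p q →
             toℕ𝔹 (b ∧ p) + toℕ𝔹 (not b ∧ c ∧ q) ≡ toℕ𝔹 (if b then p else (if c then q else false))
toℕ𝔹-if-if true  c     p q = +-identityʳ (toℕ𝔹 p)
toℕ𝔹-if-if false true  p q = refl
toℕ𝔹-if-if false false p q = refl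

sg-pos : ∀ {m} → 0 < m → sg m ≡ 1
sg-pos {suc m} _ = refl

m+[n∸1]*m+o≡n*m+o : ∀ {n} m o → 0 < n → m + ((n ∸ 1) * m + o) ≡ n * m + o
m+[n∸1]*m+o≡n*m+o {suc n} m o _ = sym (+-assoc m (n * m) o)

module _ (F : CircuitFamily) where
  open CircuitFamily F

  sg-binary : ∀ (q : ℕ → Bool) n → sg (binary (λ i → toℕ𝔹 (q i)) n) ≡ toℕ𝔹 (anyBelow F n q)
  sg-binary q zero = refl
  sg-binary q (suc n) with q n
  ... | true  = sg-pos (≤-trans (m^n>0 2 n) (≤-trans (m≤m*n (2 ^ n) 1) (m≤n+m (2 ^ n * 1) _)))
  ... | false = trans (cong sg (trans (cong (B +_) (*-zeroʳ (2 ^ n))) (+-identityʳ B))) (sg-binary q n)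
    where B = binary (λ i → toℕ𝔹 (q i)) n

  allBelow≡not-anyBelow-not : ∀ (q : ℕ → Bool) n → allBelow F n q ≡ not (anyBelow F n (λ i → not (q i)))
  allBelow≡not-anyBelow-not q zero = refl
  allBelow≡not-anyBelow-not q (suc n) with q n
  ... | true  = allBelow≡not-anyBelow-not q n
  ... | false = refl

  -- Δℓ ∈ {0,1}: the solution takes one affine step each time ℓ increments, ℓ(x) steps in total.
  odeSol₂-horner : ∀ {p} g h k (y : Vec ℕ p) H → (∀ x → h (x ∷ y) ≡ H (ℓ x)) →
                   ∀ x → odeSol₂ F g h k x y ≡ horner (2 ^ ℓ (k y)) (g y) H (ℓ x)
  odeSol₂-horner g h k y H h≡H zero = refl
  odeSol₂-horner g h k y H h≡H (suc x) with ℓ-suc x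
  ... | inj₁ ℓ-same = begin
    O + Δℓ F x * R                  ≡⟨ cong (λ d → O + d * R) (trans (cong (_∸ ℓ x) ℓ-same) (n∸n≡0 (ℓ x))) ⟩
    O + 0                           ≡⟨ +-identityʳ O ⟩
    O                               ≡⟨ odeSol₂-horner g h k y H h≡H x ⟩
    horner b (g y) H (ℓ x)          ≡⟨ cong (horner b (g y) H) (sym ℓ-same) ⟩
    horner b (g y) H (ℓ (suc x))    ∎
    where
    open ≡-Reasoning
    O = odeSol₂ F g h k x y
    b = 2 ^ ℓ (k y)
    R = (b ∸ 1) * O + h (x ∷ y)
  ... | inj₂ ℓ-incr = begin
    O + Δℓ F x * R                  ≡⟨ cong (λ d → O + d * R) (trans (cong (_∸ ℓ x) ℓ-incr) (m+n∸n≡m 1 (ℓ x))) ⟩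
    O + 1 * R                       ≡⟨ cong (O +_) (*-identityˡ R) ⟩
    O + ((b ∸ 1) * O + h (x ∷ y))   ≡⟨ m+[n∸1]*m+o≡n*m+o O (h (x ∷ y)) (m^n>0 2 (ℓ (k y))) ⟩
    b * O + h (x ∷ y)               ≡⟨ cong₂ (λ o d → b * o + d) (odeSol₂-horner g h k y H h≡H x) (h≡H x) ⟩
    horner b (g y) H (suc (ℓ x))    ≡⟨ cong (horner b (g y) H) (sym ℓ-incr) ⟩
    horner b (g y) H (ℓ (suc x))    ∎
    where
    open ≡-Reasoning
    O = odeSol₂ F g h k x y
    b = 2 ^ ℓ (k y)
    R = (b ∸ 1) * O + h (x ∷ y)

  odeSol₂-cong : ∀ {p} {g g' : Vec ℕ p → ℕ} {h h' k k'} → g ≗ g' → h ≗ h' → k ≗ k' →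
                 ∀ x y → odeSol₂ F g h k x y ≡ odeSol₂ F g' h' k' x y
  odeSol₂-cong g≗g' h≗h' k≗k' zero    y = g≗g' y
  odeSol₂-cong g≗g' h≗h' k≗k' (suc x) y
    rewrite odeSol₂-cong g≗g' h≗h' k≗k' x y | h≗h' (x ∷ y) | k≗k' y = refl

  -- The class ACDL up to pointwise equality

  record Definable (p : ℕ) (f : Vec ℕ p → ℕ) : Set where
    constructor definable
    field
      witness    : Vec ℕ p → ℕ
      derivation : ACDL F p witness
      agrees     : witness ≗ f
  open Definable

  DefinableOp₁ : (ℕ → ℕ) → Set
  DefinableOp₁ φ = ∀ {p} {a : Vec ℕ p → ℕ} → Definable p a → Definable p (λ v → φ (a v))

  DefinableOp₂ : (ℕ → ℕ → ℕ) → Set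
  DefinableOp₂ φ = ∀ {p} {a b : Vec ℕ p → ℕ} → Definable p a → Definable p b → Definable p (λ v → φ (a v) (b v))

  Definableᵇ : (p : ℕ) → (Vec ℕ p → Bool) → Set
  Definableᵇ p P = Definable p (λ v → toℕ𝔹 (P v))

  resp-≗ : ∀ {p} {f g : Vec ℕ p → ℕ} → f ≗ g → Definable p f → Definable p g
  resp-≗ f≗g (definable w d w≗f) = definable w d (λ v → trans (w≗f v) (f≗g v))

  basic : ∀ {p f} → ACDL F p f → Definable p f
  basic d = definable _ d (λ _ → refl)

  substitute : ∀ {p q f} (σ : Vec ℕ q → Vec ℕ p) → (∀ i → Definable q (λ v → lookup (σ v) i)) →
               Definable p f → Definable q (λ v → f (σ v))
  substitute σ σᴰ (definable w d w≗f) =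
    definable _ (compF d (λ i → derivation (σᴰ i))) (λ v → begin
      w (tabulate (λ i → witness (σᴰ i) v))   ≡⟨ cong w (tabulate-cong (λ i → agrees (σᴰ i) v)) ⟩
      w (tabulate (lookup (σ v)))             ≡⟨ cong w (tabulate∘lookup (σ v)) ⟩
      w (σ v)                                 ≡⟨ w≗f (σ v) ⟩
      _                                       ∎)
    where open ≡-Reasoning

  infixr 5 _∷ˢ_
  _∷ˢ_ : ∀ {p q} {t : Vec ℕ q → ℕ} {σ : Vec ℕ q → Vec ℕ p} →
         Definable q t → (∀ i → Definable q (λ v → lookup (σ v) i)) →
         ∀ i → Definable q (λ v → lookup (t v ∷ σ v) i)
  (tᴰ ∷ˢ σᴰ) zero    = tᴰ
  (tᴰ ∷ˢ σᴰ) (suc i) = σᴰ i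

  var : ∀ {p} (i : Fin p) → Definable p (λ v → lookup v i)
  var {p} i = basic (projF p i)

  headᴰ : ∀ {p} → Definable (suc p) head
  headᴰ = resp-≗ (λ { (x ∷ v) → refl }) (var zero)

  tailᴰ : ∀ {p} (i : Fin p) → Definable (suc p) (λ v → lookup (tail v) i)
  tailᴰ i = resp-≗ (λ { (x ∷ v) → refl }) (var (suc i))

  weaken : ∀ {p f} → Definable p f → Definable (suc p) (λ v → f (tail v))
  weaken = substitute tail tailᴰ

  instantiate : ∀ {p f} {t : Vec ℕ p → ℕ} → Definable (suc p) f → Definable p t → Definable p (λ v → f (t v ∷ v))
  instantiate fᴰ tᴰ = substitute _ (tᴰ ∷ˢ var) fᴰ

  substituteHead : ∀ {p f} {t : Vec ℕ (suc p) → ℕ} →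
                   Definable (suc p) f → Definable (suc p) t → Definable (suc p) (λ v → f (t v ∷ tail v))
  substituteHead fᴰ tᴰ = substitute _ (tᴰ ∷ˢ tailᴰ) fᴰ

  constant : ∀ {p} {φ : Vec ℕ 0 → ℕ} → ACDL F 0 φ → Definable p (λ _ → φ [])
  constant d = substitute (λ _ → []) (λ ()) (basic d)

  apply₁ : ∀ {φ} → ACDL F 1 φ → DefinableOp₁ (λ x → φ (x ∷ []))
  apply₁ d aᴰ = substitute _ (aᴰ ∷ˢ λ ()) (basic d)

  apply₂ : ∀ {φ} → ACDL F 2 φ → DefinableOp₂ (λ x y → φ (x ∷ y ∷ []))
  apply₂ d aᴰ bᴰ = substitute _ (aᴰ ∷ˢ bᴰ ∷ˢ λ ()) (basic d)

  0ᴰ : ∀ {p} → Definable p (λ _ → 0)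
  0ᴰ = constant zeroF

  1ᴰ : ∀ {p} → Definable p (λ _ → 1)
  1ᴰ = constant oneF

  infixl 6 _+ᴰ_ _∸ᴰ_
  _+ᴰ_ : DefinableOp₂ _+_
  _+ᴰ_ = apply₂ plusF

  _∸ᴰ_ : DefinableOp₂ _∸_
  _∸ᴰ_ = apply₂ minusF

  constᴰ : ∀ {p} n → Definable p (λ _ → n)
  constᴰ zero    = 0ᴰ
  constᴰ (suc n) = 1ᴰ +ᴰ constᴰ n

  sgᴰ : DefinableOp₁ sg
  sgᴰ = apply₁ sgF

  ℓᴰ : DefinableOp₁ ℓ
  ℓᴰ = apply₁ ℓF

  circMᴰ : DefinableOp₁ (circM F)
  circMᴰ = apply₁ circMF

  circL0inᴰ : DefinableOp₂ (circL0in F)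
  circL0inᴰ = apply₂ circL0inF

  circL0negᴰ : DefinableOp₂ (circL0neg F)
  circL0negᴰ = apply₂ circL0negF

  circLᴰ : ∀ e → 1 ≤ e → e ≤ depth → DefinableOp₂ (circL F e)
  circLᴰ e 1≤e e≤d = apply₂ (circLF e 1≤e e≤d)

  circCᴰ : ∀ {p} {x a b : Vec ℕ p → ℕ} → Definable p x → Definable p a → Definable p b →
           Definable p (λ v → circC F (x v) (a v) (b v))
  circCᴰ {x = x} {a} {b} xᴰ aᴰ bᴰ =
    substitute (λ v → x v ∷ a v ∷ b v ∷ []) (xᴰ ∷ˢ aᴰ ∷ˢ bᴰ ∷ˢ λ ()) (basic circCF)

  notᴰ : ∀ {p P} → Definableᵇ p P → Definableᵇ p (λ v → not (P v))
  notᴰ {P = P} Pᴰ = resp-≗ (λ v → toℕ𝔹-not (P v)) (1ᴰ ∸ᴰ Pᴰ)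

  infixr 6 _∧ᴰ_
  infixr 5 _∨ᴰ_
  _∧ᴰ_ : ∀ {p P Q} → Definableᵇ p P → Definableᵇ p Q → Definableᵇ p (λ v → P v ∧ Q v)
  _∧ᴰ_ {P = P} {Q} Pᴰ Qᴰ = resp-≗ (λ v → toℕ𝔹-∧ (P v) (Q v)) (Pᴰ +ᴰ Qᴰ ∸ᴰ 1ᴰ)

  _∨ᴰ_ : ∀ {p P Q} → Definableᵇ p P → Definableᵇ p Q → Definableᵇ p (λ v → P v ∨ Q v)
  _∨ᴰ_ {P = P} {Q} Pᴰ Qᴰ = resp-≗ (λ v → toℕ𝔹-∨ (P v) (Q v)) (sgᴰ (Pᴰ +ᴰ Qᴰ))

  <ᵇᴰ : DefinableOp₂ (λ m n → toℕ𝔹 (m <ᵇ n))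
  <ᵇᴰ {a = m} {n} mᴰ nᴰ = resp-≗ (λ v → toℕ𝔹-<ᵇ (m v) (n v)) (sgᴰ (nᴰ ∸ᴰ mᴰ))

  ifᴰ : ∀ {p P Q} c → Definableᵇ p P → Definableᵇ p Q → Definableᵇ p (λ v → if c then P v else Q v)
  ifᴰ true  Pᴰ Qᴰ = Pᴰ
  ifᴰ false Pᴰ Qᴰ = Qᴰ

  ode₂ᴰ : ∀ {p g h k} → Definable p g → Definable (suc p) h → Definable p k →
          (∀ w → h w ≤ 1) → (∀ x y → h (x ∷ y) ≡ 1 → k y ≢ 0) →
          Definable (suc p) (uncurryODE F (odeSol₂ F g h k))
  ode₂ᴰ (definable g' dg g'≗g) (definable h' dh h'≗h) (definable k' dk k'≗k) h≤1 h≡1⇒k≢0 =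
    definable _
      (ode₂F dg dh dk (λ w → subst (_≤ 1) (sym (h'≗h w)) (h≤1 w))
                      (λ x y h'≡1 → subst (_≢ 0) (sym (k'≗k y)) (h≡1⇒k≢0 x y (trans (sym (h'≗h _)) h'≡1))))
      (λ { (x ∷ y) → odeSol₂-cong g'≗g h'≗h k'≗k x y })

  -- Horner reads digits from the top: at step ℓ(x) the ODE is fed digit ℓ(t) - 1 - ℓ(x) of P.
  binaryᴰ : ∀ {p} {P : Vec ℕ (suc p) → ℕ} {t : Vec ℕ p → ℕ} →
            Definable (suc p) P → (∀ w → P w ≤ 1) → Definable p t →
            Definable p (λ v → binary (λ i → P (i ∷ v)) (ℓ (t v)))
  binaryᴰ {p} {P} {t} Pᴰ P≤1 tᴰ =
    resp-≗ (λ v → trans (odeSol₂-horner (λ _ → 0) h (λ _ → 1) v _ (λ _ → refl) (t v))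
                      (horner-reversed-binary (λ i → P (i ∷ v)) (ℓ (t v))))
         (instantiate (ode₂ᴰ 0ᴰ hᴰ 1ᴰ (λ w → P≤1 _) (λ _ _ _ ())) tᴰ)
    where
    h : Vec ℕ (suc p) → ℕ
    h w = P ((ℓ (t (tail w)) ∸ suc (ℓ (head w))) ∷ tail w)
    hᴰ : Definable (suc p) h
    hᴰ = substituteHead Pᴰ (ℓᴰ (weaken tᴰ) ∸ᴰ (1ᴰ +ᴰ ℓᴰ headᴰ))

  smashᴰ : DefinableOp₂ smash
  smashᴰ {a = a} {b} aᴰ bᴰ =
    resp-≗ (λ v → begin
           odeSol₂ F (λ _ → 1) (λ _ → 0) a (b v) v           ≡⟨ odeSol₂-horner _ _ a v _ (λ _ → refl) (b v) ⟩
           horner (2 ^ ℓ (a v)) 1 (λ _ → 0) (ℓ (b v))        ≡⟨ horner-pow (2 ^ ℓ (a v)) (ℓ (b v)) ⟩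
           (2 ^ ℓ (a v)) ^ ℓ (b v)                           ≡⟨ ^-*-assoc 2 (ℓ (a v)) (ℓ (b v)) ⟩
           smash (a v) (b v)                                 ∎)
         (instantiate (ode₂ᴰ 1ᴰ 0ᴰ aᴰ (λ _ → z≤n) (λ _ _ ())) bᴰ)
    where open ≡-Reasoning

  stretchᴰ : ∀ c i → DefinableOp₁ (stretch c i)
  stretchᴰ c zero    xᴰ = constᴰ c
  stretchᴰ c (suc i) xᴰ = smashᴰ (stretchᴰ c i xᴰ) (1ᴰ +ᴰ (xᴰ +ᴰ xᴰ))

  -- Gates of C_{ℓ(x)}

  bound : ℕ → ℕ
  bound = stretch (2 ^ (2 * polyC)) polyK

  boundᴰ : DefinableOp₁ bound
  boundᴰ = stretchᴰ (2 ^ (2 * polyC)) polyK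

  size≤ℓ-bound : ∀ x → size (ℓ x) ≤ ℓ (bound x)
  size≤ℓ-bound x = begin
    size (ℓ x)                                     ≤⟨ size-poly (ℓ x) ⟩
    polyC * ℓ x ^ polyK + polyC                    ≤⟨ poly-≤ polyC polyK (ℓ x) ⟩
    2 * polyC * suc (ℓ x) ^ polyK                  ≤⟨ *-monoˡ-≤ (suc (ℓ x) ^ polyK) (ℓ-2^ (2 * polyC)) ⟩
    ℓ (2 ^ (2 * polyC)) * suc (ℓ x) ^ polyK        ≤⟨ ℓ-stretch (2 ^ (2 * polyC)) polyK x ⟩
    ℓ (bound x)                                    ∎
    where open ≤-Reasoning

  edge-outside : ∀ n a b → size n ≤ a → edge n a b ≡ false
  edge-outside n a b size≤a with edge n a b in eq
  ... | true  = contradiction (proj₁ (edge-ok n a b eq)) (≤⇒≯ size≤a)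
  ... | false = refl

  anyGateᴰ : ∀ {p} {P : ℕ → Vec ℕ p → Bool} {x : Vec ℕ p → ℕ} →
             Definableᵇ (suc p) (λ w → P (head w) (tail w)) → Definable p x →
             (∀ v i → size (ℓ (x v)) ≤ i → P i v ≡ false) →
             Definableᵇ p (λ v → anyBelow F (size (ℓ (x v))) (λ i → P i v))
  anyGateᴰ {P = P} {x} Pᴰ xᴰ P-outside =
    resp-≗ (λ v → begin
           sg (binary (λ i → toℕ𝔹 (P i v)) (ℓ (bound (x v))))
             ≡⟨ cong sg (binary-vanishing _ (size≤ℓ-bound (x v)) (λ i s≤i → cong toℕ𝔹 (P-outside v i s≤i))) ⟩
           sg (binary (λ i → toℕ𝔹 (P i v)) (size (ℓ (x v))))
             ≡⟨ sg-binary (λ i → P i v) (size (ℓ (x v))) ⟩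
           toℕ𝔹 (anyBelow F (size (ℓ (x v))) (λ i → P i v))  ∎)
         (sgᴰ (binaryᴰ Pᴰ (λ _ → toℕ𝔹≤1 _) (boundᴰ xᴰ)))
    where open ≡-Reasoning

  allGateᴰ : ∀ {p} {Q : ℕ → Vec ℕ p → Bool} {x : Vec ℕ p → ℕ} →
             Definableᵇ (suc p) (λ w → Q (head w) (tail w)) → Definable p x →
             (∀ v i → size (ℓ (x v)) ≤ i → Q i v ≡ true) →
             Definableᵇ p (λ v → allBelow F (size (ℓ (x v))) (λ i → Q i v))
  allGateᴰ {Q = Q} {x} Qᴰ xᴰ Q-outside =
    resp-≗ (λ v → cong toℕ𝔹 (sym (allBelow≡not-anyBelow-not (λ i → Q i v) (size (ℓ (x v))))))
         (notᴰ (anyGateᴰ (notᴰ Qᴰ) xᴰ (λ v i s≤i → cong not (Q-outside v i s≤i))))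

  gateValueᴰ : ∀ e → DefinableOp₂ (λ a x → toℕ𝔹 (valAt F (ℓ x) x e a))
  gateValueᴰ zero {a = a} {x} aᴰ xᴰ =
    resp-≗ (λ v → toℕ𝔹-if-if (a v <ᵇ ℓ (x v)) (a v <ᵇ 2 * ℓ (x v)) _ _)
         (circL0inᴰ aᴰ xᴰ +ᴰ circL0negᴰ aᴰ xᴰ)
  gateValueᴰ (suc e) {a = b} {x} bᴰ xᴰ =
    ifᴰ (suc e % 2 ≡ᵇ 1)
        (anyGateᴰ (edgeᴰ ∧ᴰ valueᴰ) xᴰ (λ v i s≤i → cong (_∧ value v i) (edge-outside _ i (b v) s≤i)))
        (allGateᴰ (notᴰ edgeᴰ ∨ᴰ valueᴰ) xᴰ (λ v i s≤i → cong (λ c → not c ∨ value v i) (edge-outside _ i (b v) s≤i)))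
    where
    value = λ v i → valAt F (ℓ (x v)) (x v) e i
    edgeᴰ = circCᴰ (weaken xᴰ) headᴰ (weaken bᴰ)
    valueᴰ = gateValueᴰ e headᴰ (weaken xᴰ)

  atLevel : ℕ → ℕ → ℕ → Bool
  atLevel e a x = (a <ᵇ size (ℓ x)) ∧ (level (ℓ x) a ≡ᵇ e)

  atLevel-outside : ∀ e a x → size (ℓ x) ≤ a → atLevel e a x ≡ false
  atLevel-outside e a x size≤a = cong (_∧ (level (ℓ x) a ≡ᵇ e)) (<ᵇ-false size≤a)

  atLevel-level : ∀ e a x → a < size (ℓ x) → level (ℓ x) a ≡ e → atLevel e a x ≡ true
  atLevel-level e a x a<size lv≡e = cong₂ _∧_ (<ᵇ-true a<size) (dec-true (level (ℓ x) a ≟ e) lv≡e)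

  gateAtLevel≤ : ℕ → ℕ → ℕ → Bool
  gateAtLevel≤ zero    a x = false
  gateAtLevel≤ (suc j) a x = atLevel (suc j) a x ∨ gateAtLevel≤ j a x

  gateAtLevel≤ᴰ : ∀ j → j ≤ depth → DefinableOp₂ (λ a x → toℕ𝔹 (gateAtLevel≤ j a x))
  gateAtLevel≤ᴰ zero    _   aᴰ xᴰ = 0ᴰ
  gateAtLevel≤ᴰ (suc j) j<d aᴰ xᴰ =
    circLᴰ (suc j) (s≤s z≤n) j<d aᴰ xᴰ ∨ᴰ gateAtLevel≤ᴰ j (<⇒≤ j<d) aᴰ xᴰ

  gateAtLevel≤-outside : ∀ j a x → size (ℓ x) ≤ a → gateAtLevel≤ j a x ≡ false
  gateAtLevel≤-outside zero    a x _      = refl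
  gateAtLevel≤-outside (suc j) a x size≤a =
    cong₂ _∨_ (atLevel-outside (suc j) a x size≤a) (gateAtLevel≤-outside j a x size≤a)

  gateAtLevel≤-level : ∀ j a x → a < size (ℓ x) → 1 ≤ level (ℓ x) a → level (ℓ x) a ≤ j →
                       gateAtLevel≤ j a x ≡ true
  gateAtLevel≤-level zero    a x a<size 1≤lv lv≤0   = contradiction (≤-trans 1≤lv lv≤0) λ ()
  gateAtLevel≤-level (suc j) a x a<size 1≤lv lv≤1+j with m≤n⇒m<n∨m≡n lv≤1+j
  ... | inj₁ (s≤s lv≤j) =
    trans (cong (atLevel (suc j) a x ∨_) (gateAtLevel≤-level j a x a<size 1≤lv lv≤j)) (∨-zeroʳ (atLevel (suc j) a x))
  ... | inj₂ lv≡1+j     = cong (_∨ gateAtLevel≤ j a x) (atLevel-level (suc j) a x a<size lv≡1+j)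

  <ᵇsize≡input∨gateAtLevel≤ : ∀ a x → (a <ᵇ size (ℓ x)) ≡ ((a <ᵇ 2 * ℓ x) ∨ gateAtLevel≤ depth a x)
  <ᵇsize≡input∨gateAtLevel≤ a x with a <? size (ℓ x) | level (ℓ x) a in lv≡
  ... | no a≮size  | _     = begin
    (a <ᵇ size (ℓ x))                         ≡⟨ <ᵇ-false (≮⇒≥ a≮size) ⟩
    false ∨ false                             ≡⟨ cong₂ _∨_ (sym (<ᵇ-false 2n≤a)) (sym (gateAtLevel≤-outside depth a x (≮⇒≥ a≮size))) ⟩
    (a <ᵇ 2 * ℓ x) ∨ gateAtLevel≤ depth a x   ∎
    where
    open ≡-Reasoning
    2n≤a = ≤-trans (inputs-fit (ℓ x)) (≮⇒≥ a≮size)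
  ... | yes a<size | zero  = begin
    (a <ᵇ size (ℓ x))                         ≡⟨ <ᵇ-true a<size ⟩
    true ∨ gateAtLevel≤ depth a x             ≡⟨ cong (_∨ gateAtLevel≤ depth a x) (sym (<ᵇ-true (proj₁ (level0 (ℓ x) a a<size) lv≡))) ⟩
    (a <ᵇ 2 * ℓ x) ∨ gateAtLevel≤ depth a x   ∎
    where open ≡-Reasoning
  ... | yes a<size | suc e = begin
    (a <ᵇ size (ℓ x))                         ≡⟨ <ᵇ-true a<size ⟩
    true                                      ≡⟨ sym (∨-zeroʳ (a <ᵇ 2 * ℓ x)) ⟩
    (a <ᵇ 2 * ℓ x) ∨ true                     ≡⟨ cong ((a <ᵇ 2 * ℓ x) ∨_) (sym (gateAtLevel≤-level depth a x a<size 1≤lv lv≤d)) ⟩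
    (a <ᵇ 2 * ℓ x) ∨ gateAtLevel≤ depth a x   ∎
    where
    open ≡-Reasoning
    1≤lv = subst (1 ≤_) (sym lv≡) (s≤s z≤n)
    lv≤d = level-≤d (ℓ x) a a<size

  isGateᴰ : DefinableOp₂ (λ a x → toℕ𝔹 (a <ᵇ size (ℓ x)))
  isGateᴰ aᴰ xᴰ =
    resp-≗ (λ v → cong toℕ𝔹 (sym (<ᵇsize≡input∨gateAtLevel≤ _ _)))
         (<ᵇᴰ aᴰ (ℓᴰ xᴰ +ᴰ (ℓᴰ xᴰ +ᴰ 0ᴰ)) ∨ᴰ gateAtLevel≤ᴰ depth ≤-refl aᴰ xᴰ)

  sizeᴰ : DefinableOp₁ (λ x → size (ℓ x))
  sizeᴰ {a = x} xᴰ =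
    resp-≗ (λ v → ℓ-binary-<ᵇ _ (size≤ℓ-bound (x v)))
         (ℓᴰ (binaryᴰ (isGateᴰ headᴰ (weaken xᴰ)) (λ _ → toℕ𝔹≤1 _) (boundᴰ xᴰ)))

  outputDigit : ℕ → ℕ → Bool
  outputDigit x i = (i <ᵇ outs (ℓ x)) ∧ valAt F (ℓ x) x depth (size (ℓ x) ∸ outs (ℓ x) + i)

  outputDigitᴰ : ∀ {p} {x : Vec ℕ p → ℕ} → Definable p x →
                 Definableᵇ (suc p) (λ w → outputDigit (x (tail w)) (head w))
  outputDigitᴰ xᴰ = <ᵇᴰ headᴰ outsᴰ ∧ᴰ gateValueᴰ depth (sizeᴰ (weaken xᴰ) ∸ᴰ outsᴰ +ᴰ headᴰ) (weaken xᴰ)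
    where
    outsᴰ = circMᴰ (ℓᴰ (weaken xᴰ))

  output-gate-level : ∀ n {i} → i < outs n → level n (size n ∸ outs n + i) ≡ depth
  output-gate-level n {i} i<m = outs-level n _ (m≤m+n _ i) gate<size
    where
    gate<size : size n ∸ outs n + i < size n
    gate<size = subst (size n ∸ outs n + i <_) (m∸n+n≡m (outs-fit n)) (+-monoʳ-< (size n ∸ outs n) i<m)

  outputSum≡binary : ∀ n x m j → outputSum F n x m j ≡ binary (λ i → toℕ𝔹 (gateVal F n x (size n ∸ m + i))) j
  outputSum≡binary n x m zero    = refl
  outputSum≡binary n x m (suc j) =
    cong (_+ 2 ^ j * toℕ𝔹 (gateVal F n x (size n ∸ m + j))) (outputSum≡binary n x m j)

  binary-outputDigit : ∀ x → binary (λ i → toℕ𝔹 (outputDigit x i)) (ℓ (bound x)) ≡ output F (ℓ x) x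
  binary-outputDigit x = begin
    binary (λ i → toℕ𝔹 (outputDigit x i)) (ℓ (bound x))
      ≡⟨ binary-vanishing _ (≤-trans (outs-fit n) (size≤ℓ-bound x))
                          (λ i m≤i → cong (λ c → toℕ𝔹 (c ∧ valAt F n x depth (size n ∸ m + i))) (<ᵇ-false m≤i)) ⟩
    binary (λ i → toℕ𝔹 (outputDigit x i)) m
      ≡⟨ binary-cong m (λ i i<m → cong₂ (λ c e → toℕ𝔹 (c ∧ valAt F n x e (size n ∸ m + i)))
                                        (<ᵇ-true i<m) (sym (output-gate-level n i<m))) ⟩
    binary (λ i → toℕ𝔹 (gateVal F n x (size n ∸ m + i))) m
      ≡⟨ sym (outputSum≡binary n x m m) ⟩
    output F n x
      ∎
    where
    open ≡-Reasoning
    n = ℓ x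
    m = outs n

  outputᴰ : DefinableOp₁ (λ x → output F (ℓ x) x)
  outputᴰ {a = x} xᴰ =
    resp-≗ (λ v → binary-outputDigit (x v)) (binaryᴰ (outputDigitᴰ xᴰ) (λ _ → toℕ𝔹≤1 _) (boundᴰ xᴰ))

proposition8 : (F : CircuitFamily) (f : ℕ → ℕ) → Computes F f → InACDL F f
proposition8 F f computes =
  witness fᴰ , derivation fᴰ , λ x → trans (agrees fᴰ (x ∷ [])) (sym (computes x))
  where
  fᴰ = outputᴰ F (var F zero)
  open Definable
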